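{- Let $s$ be a positive integer and let $G$ and $H$ be graphs such that $H$ is a retract of $G$. Then $c_{s,s}(G) \ge c_{s,s}(H)$.
   Context: All graphs are finite, undirected and reflexive (every vertex carries a loop, so a player may always stay put). In the speed-$(s,s)$ Cops and Robbers game on a graph $G$ ($s$ a positive integer), the cops first place themselves on vertices, then the robber places himself on a vertex; play then proceeds in rounds, each consisting of a cops' turn followed by a robber's turn. On the cops' turn each cop moves along a walk of length at most $s$ (possibly staying put); on the robber's turn he moves along a walk of length at most $s$ that does not pass through a vertex occupied by a cop. The cops win if at some point some cop occupies the robber's vertex; the robber wins if he evades capture forever. $c_{s,s}(G)$ is the minimum number of cops that can guarantee a win. A homomorphism $\phi:V(G)\to V(H)$ maps edges to edges; $H$ is a retract of $G$ if $H$ is a subgraph of $G$ and there is a homomorphism $\phi:V(G)\to V(H)$ with $\phi(v)=v$ for all $v\in V(H)$. -}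

module Defs where

open import Data.Nat using (ℕ; zero; suc; _≤_)
open import Data.Fin using (Fin)
open import Data.Product using (Σ; ∃; _×_)
open import Data.Unit using (⊤)
open import Relation.Binary.PropositionalEquality using (_≡_; _≢_)

record Graph (n : ℕ) : Set₁ where
  field
    _∼_   : Fin n → Fin n → Set
    loop  : ∀ v → v ∼ v
    symm  : ∀ {u v} → u ∼ v → v ∼ u

open Graph public

IsHom : ∀ {m n} → Graph m → Graph n → (Fin m → Fin n) → Set
IsHom G H f = ∀ {u v} → _∼_ G u v → _∼_ H (f u) (f v)

record IsRetract {m n} (H : Graph n) (G : Graph m) : Set where
  field
    ι        : Fin n → Fin m
    ι-inj    : ∀ {u v} → ι u ≡ ι v → u ≡ v
    ι-edges  : IsHom H G ι
    φ        : Fin m → Fin n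
    φ-hom    : IsHom G H φ
    φ-fix    : ∀ v → φ (ι v) ≡ v

-- Walks of length at most s from u to v all of whose vertices satisfy P.
data Walk {n} (G : Graph n) (P : Fin n → Set) : ℕ → Fin n → Fin n → Set where
  stay : ∀ {s u} → P u → Walk G P s u u
  step : ∀ {s u w v} → P u → _∼_ G u w → Walk G P s w v → Walk G P (suc s) u v

Cops : ℕ → ℕ → Set
Cops n k = Fin k → Fin n

Caught : ∀ {n k} → Cops n k → Fin n → Set
Caught {k = k} c r = ∃ λ (i : Fin k) → c i ≡ r

-- The robber's walk may not pass through (including start/end) a cop vertex.
Free : ∀ {n k} → Cops n k → Fin n → Set
Free {k = k} c v = ∀ (i : Fin k) → c i ≢ v

-- CopsWinFrom G s c r : it is the cops' turn, cops at c, robber at r, and the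
-- cops can force capture in finitely many rounds (inductive = least fixed point).
data CopsWinFrom {n} (G : Graph n) (s : ℕ) {k : ℕ} : Cops n k → Fin n → Set where
  caught : ∀ {c r} → Caught c r → CopsWinFrom G s c r
  move   : ∀ {c r} (c' : Cops n k)
         → (∀ i → Walk G (λ _ → ⊤) s (c i) (c' i))
         → (∀ r' → Walk G (Free c') s r r' → CopsWinFrom G s c' r')
         → CopsWinFrom G s c r

CopsWin : ∀ {n} → Graph n → ℕ → ℕ → Set
CopsWin {n} G s k = Σ (Cops n k) λ c → ∀ (r : Fin n) → CopsWinFrom G s c r

IsCopNumber : ∀ {n} → ℕ → Graph n → ℕ → Set
IsCopNumber s G c = CopsWin G s c × (∀ k → CopsWin G s k → c ≤ k)

{-# OPTIONS --safe #-}
module Submission where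

-- The cops on H play the shadow under φ of a winning strategy on G, which they
-- run against the robber's position viewed in G through ι. Since φ fixes H, a
-- capture in G is a capture of the shadows; and a robber walk in H that avoids
-- the shadow cops is, through ι, a walk in G avoiding the real cops, because a
-- cop standing on ι v would cast its shadow on v. Hence k cops winning on G
-- yield k cops winning on H, and minimality of c_{s,s}(H) gives the bound.

open import Defs
open import Data.Nat using (ℕ; _≤_)
open import Data.Fin using (Fin)
open import Data.Product using (_,_)
open import Data.Unit using (tt)
open import Function using (_∘_)
open import Relation.Binary.PropositionalEquality using (_≡_; trans; cong)

mapWalk : ∀ {m n} {G : Graph m} {H : Graph n} {P : Fin m → Set} {Q : Fin n → Set}
          (f : Fin m → Fin n) → IsHom G H f → (∀ {v} → P v → Q (f v))
        → ∀ {s u v} → Walk G P s u v → Walk H Q s (f u) (f v)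
mapWalk f f-hom pq (stay p)     = stay (pq p)
mapWalk f f-hom pq (step p e w) = step (pq p) (f-hom e) (mapWalk f f-hom pq w)

module _ {m n} {G : Graph m} {H : Graph n} (R : IsRetract H G) (s : ℕ) {k : ℕ} where
  open IsRetract R

  φ-on-ι : ∀ {x v} → x ≡ ι v → φ x ≡ v
  φ-on-ι {v = v} x≡ιv = trans (cong φ x≡ιv) (φ-fix v)

  Caught-φ : ∀ {c : Cops m k} {v} → Caught c (ι v) → Caught (φ ∘ c) v
  Caught-φ (i , c-i≡ιv) = i , φ-on-ι c-i≡ιv

  Free-ι : ∀ {c : Cops m k} {v} → Free (φ ∘ c) v → Free c (ι v)
  Free-ι free i c-i≡ιv = free i (φ-on-ι c-i≡ιv)

  CopsWinFrom-retract : ∀ {c : Cops m k} {r} → CopsWinFrom G s c (ι r) → CopsWinFrom H s (φ ∘ c) r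
  CopsWinFrom-retract (caught c-caught) = caught (Caught-φ c-caught)
  CopsWinFrom-retract (move c' cop-walks win) =
    move (φ ∘ c')
         (λ i → mapWalk φ φ-hom (λ _ → tt) (cop-walks i))
         (λ r' robber-walk → CopsWinFrom-retract (win (ι r') (mapWalk ι ι-edges Free-ι robber-walk)))

  CopsWin-retract : CopsWin G s k → CopsWin H s k
  CopsWin-retract (c , win) = φ ∘ c , CopsWinFrom-retract ∘ win ∘ ι

theorem2p3 : (s : ℕ) → 1 ≤ s → ∀ {m n} (G : Graph m) (H : Graph n)
           → IsRetract H G
           → ∀ cG cH → IsCopNumber s G cG → IsCopNumber s H cH → cH ≤ cG
theorem2p3 s _ G H R cG cH (cG-wins , _) (_ , cH-minimal) =
  cH-minimal cG (CopsWin-retract R s cG-wins)
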